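{- Let $(L,\preceq)$ be a lattice and let $\delta$ be an equivalence relation on $L$. Then $\delta$ is a local congruence on $L$ if and only if, for all $a,b,c\in L$, the following two properties hold: (i) if $(a,b)\in\delta$ and $a\preceq c\preceq b$, then $(a,c)\in\delta$; (ii) $(a,b)\in\delta$ if and only if $(a\wedge b,\,a\vee b)\in\delta$.
   Context: A local congruence on a lattice $(L,\preceq)$ (with meet $\wedge$ and join $\vee$) is an equivalence relation $\delta$ on $L$ such that (1) each equivalence class of $\delta$ is a sublattice of $L$ (closed under $\wedge$ and $\vee$), and (2) each equivalence class of $\delta$ is convex, i.e. if $x,y$ belong to a class and $x\preceq z\preceq y$, then $z$ belongs to that class. -}

module Defs where

open import Level using (Level; _⊔_)
open import Data.Product using (_×_)
open import Relation.Binary.Core using (Rel; _⇒_)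
open import Relation.Binary.Structures using (IsEquivalence)
open import Relation.Binary.Lattice using (Lattice)

-- An equivalence relation on the carrier of a lattice (a setoid, with
-- equality _≈_): an IsEquivalence relation that contains _≈_
-- (so its classes are subsets of the setoid, i.e. respect _≈_).
record IsEquivRelOn {c ℓ₁ ℓ₂ ℓ : Level} (L : Lattice c ℓ₁ ℓ₂) (δ : Rel (Lattice.Carrier L) ℓ)
       : Set (c ⊔ ℓ₁ ⊔ ℓ) where
  field
    isEquivalence : IsEquivalence δ
    ≈⇒δ           : Lattice._≈_ L ⇒ δ

module _ {c ℓ₁ ℓ₂ ℓ : Level} (L : Lattice c ℓ₁ ℓ₂) (δ : Rel (Lattice.Carrier L) ℓ) where
  open Lattice L

  Class : Carrier → Carrier → Set ℓ
  Class x y = δ x y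

  ClassesSublattices : Set (c ⊔ ℓ)
  ClassesSublattices = ∀ x y z → Class x y → Class x z →
                        Class x (y ∧ z) × Class x (y ∨ z)

  ClassesConvex : Set (c ⊔ ℓ ⊔ ℓ₂)
  ClassesConvex = ∀ x y z w → Class x y → Class x w → y ≤ z → z ≤ w → Class x z

  record IsLocalCongruence : Set (c ⊔ ℓ₁ ⊔ ℓ₂ ⊔ ℓ) where
    field
      isEquivRel  : IsEquivRelOn L δ
      sublattices : ClassesSublattices
      convex      : ClassesConvex

{-# OPTIONS --safe #-}
-- A class is convex iff it is closed under intervals [a , b] between related
-- elements.  Since a ∧ b ≤ a , b ≤ a ∨ b, interval closure turns
-- δ (a ∧ b) (a ∨ b) into δ a b; conversely, if y and z lie in a class, then so
-- do y ∧ z and y ∨ z, as δ y z gives δ (y ∧ z) (y ∨ z) and y lies between them.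
module Submission where

open import Defs
open import Level using (_⊔_)
open import Data.Product using (_×_; _,_)
open import Function.Bundles using (_⇔_; mk⇔; Equivalence)
open import Relation.Binary.Core using (Rel)
open import Relation.Binary.Lattice using (Lattice)
open import Relation.Binary.Structures using (IsEquivalence)

module _ {c ℓ₁ ℓ₂ ℓ} (L : Lattice c ℓ₁ ℓ₂) (δ : Rel (Lattice.Carrier L) ℓ) where
  open Lattice L

  IntervalClosed : Set (c ⊔ ℓ₂ ⊔ ℓ)
  IntervalClosed = ∀ a b x → δ a b → a ≤ x → x ≤ b → δ a x

  MeetJoinInvariant : Set (c ⊔ ℓ)
  MeetJoinInvariant = ∀ a b → δ a b ⇔ δ (a ∧ b) (a ∨ b)

  module _ (δ-isEquivalence : IsEquivalence δ) where
    open IsEquivalence δ-isEquivalence renaming (refl to δ-refl; sym to δ-sym; trans to δ-trans)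

    convex⇒intervalClosed : ClassesConvex L δ → IntervalClosed
    convex⇒intervalClosed convex a b x ab a≤x x≤b = convex a a x b δ-refl ab a≤x x≤b

    intervalClosed⇒convex : IntervalClosed → ClassesConvex L δ
    intervalClosed⇒convex closed x y z w xy xw y≤z z≤w =
      δ-trans xy (closed y w z (δ-trans (δ-sym xy) xw) y≤z z≤w)

    sublattices⇒δ-∧∨ : ClassesSublattices L δ → ∀ {a b} → δ a b → δ (a ∧ b) (a ∨ b)
    sublattices⇒δ-∧∨ sublattices {a} {b} ab with sublattices a a b δ-refl ab
    ... | a-a∧b , a-a∨b = δ-trans (δ-sym a-a∧b) a-a∨b

    intervalClosed⇒δ-∧∨⇒δ : IntervalClosed → ∀ {a b} → δ (a ∧ b) (a ∨ b) → δ a b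
    intervalClosed⇒δ-∧∨⇒δ closed {a} {b} h =
      δ-trans (δ-sym (closed (a ∧ b) (a ∨ b) a h (x∧y≤x a b) (x≤x∨y a b)))
              (closed (a ∧ b) (a ∨ b) b h (x∧y≤y a b) (y≤x∨y a b))

    intervalClosed⇒sublattices : IntervalClosed →
                                 (∀ {a b} → δ a b → δ (a ∧ b) (a ∨ b)) →
                                 ClassesSublattices L δ
    intervalClosed⇒sublattices closed δ⇒δ-∧∨ x y z xy xz = x-y∧z , δ-trans x-y∧z y∧z-y∨z
      where
      y∧z-y∨z : δ (y ∧ z) (y ∨ z)
      y∧z-y∨z = δ⇒δ-∧∨ (δ-trans (δ-sym xy) xz)

      x-y∧z : δ x (y ∧ z)
      x-y∧z = δ-trans xy (δ-sym (closed (y ∧ z) (y ∨ z) y y∧z-y∨z (x∧y≤x y z) (x≤x∨y y z)))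

    localCongruence⇒meetJoinInvariant : IsLocalCongruence L δ → MeetJoinInvariant
    localCongruence⇒meetJoinInvariant lc _ _ =
      mk⇔ (sublattices⇒δ-∧∨ sublattices) (intervalClosed⇒δ-∧∨⇒δ (convex⇒intervalClosed convex))
      where open IsLocalCongruence lc

proposition15 : ∀ {c ℓ₁ ℓ₂ ℓ} (L : Lattice c ℓ₁ ℓ₂) (δ : Rel (Lattice.Carrier L) ℓ) →
    IsEquivRelOn L δ →
    IsLocalCongruence L δ ⇔
      ((∀ a b x → δ a b → Lattice._≤_ L a x → Lattice._≤_ L x b → δ a x)
       × (∀ a b → δ a b ⇔ δ (Lattice._∧_ L a b) (Lattice._∨_ L a b)))
proposition15 L δ eqv = mk⇔ toConditions fromConditions
  where
  δ-isEquivalence : IsEquivalence δ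
  δ-isEquivalence = IsEquivRelOn.isEquivalence eqv

  toConditions : IsLocalCongruence L δ → IntervalClosed L δ × MeetJoinInvariant L δ
  toConditions lc =
      convex⇒intervalClosed L δ δ-isEquivalence (IsLocalCongruence.convex lc)
    , localCongruence⇒meetJoinInvariant L δ δ-isEquivalence lc

  fromConditions : IntervalClosed L δ × MeetJoinInvariant L δ → IsLocalCongruence L δ
  fromConditions (closed , meetJoin) = record
    { isEquivRel  = eqv
    ; sublattices = intervalClosed⇒sublattices L δ δ-isEquivalence closed
                      (λ {a} {b} → Equivalence.to (meetJoin a b))
    ; convex      = intervalClosed⇒convex L δ δ-isEquivalence closed
    }
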